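{- Let $p,q$ be positive integers with $p<q$, and consider a $p \times q$ matrix whose $(i,j)$-th entry is $m_{i,j}$ (all entries distinct). Let $M$ be the complete graph whose vertices are the entries of the matrix. Then there exists a matching of $M$ satisfying the following conditions: (i) the two endpoints of each edge of the matching lie in different columns; (ii) if $e_1$ and $e_2$ are two distinct edges of the matching and an endpoint of $e_1$ and an endpoint of $e_2$ lie in the same column, then the other endpoints of $e_1$ and $e_2$ lie in distinct columns; (iii) the matching saturates all but at most one vertex of $M$ in each column. -}

module Defs where

open import Data.Nat using (ℕ)
open import Data.Fin using (Fin)
open import Data.List using (List; length; lookup)
open import Data.Product using (_×_; _,_; proj₁; proj₂; ∃)
open import Data.Sum using (_⊎_)
open import Relation.Binary.PropositionalEquality using (_≡_; _≢_)
open import Relation.Nullary using (¬_)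

-- The entry m_{i,j} of the p × q matrix is identified with its position
-- (i , j) : row i, column j.  Since all entries are distinct, this is a
-- bijection between the vertex set of M and Fin p × Fin q.
Vertex : ℕ → ℕ → Set
Vertex p q = Fin p × Fin q

col : ∀ {p q} → Vertex p q → Fin q
col = proj₂

Edge : ℕ → ℕ → Set
Edge p q = Vertex p q × Vertex p q

_∈ₑ_ : ∀ {p q} → Vertex p q → Edge p q → Set
v ∈ₑ e = v ≡ proj₁ e ⊎ v ≡ proj₂ e

Ends : ∀ {p q} → Edge p q → Vertex p q → Vertex p q → Set
Ends e u u' = (u , u') ≡ e ⊎ (u' , u) ≡ e

-- A matching of M: a list of edges (a loop-free edge of the complete graph),
-- pairwise vertex-disjoint (distinct list positions = distinct edges).
record IsMatching {p q : ℕ} (E : List (Edge p q)) : Set where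
  field
    loopless : ∀ (i : Fin (length E)) → proj₁ (lookup E i) ≢ proj₂ (lookup E i)
    disjoint : ∀ (i j : Fin (length E)) → i ≢ j →
               ∀ (v : Vertex p q) → v ∈ₑ lookup E i → ¬ (v ∈ₑ lookup E j)

Saturated : ∀ {p q} → List (Edge p q) → Vertex p q → Set
Saturated E v = ∃ λ (i : Fin (length E)) → v ∈ₑ lookup E i

CondI : ∀ {p q} → List (Edge p q) → Set
CondI E = ∀ (i : Fin (length E)) → col (proj₁ (lookup E i)) ≢ col (proj₂ (lookup E i))

CondII : ∀ {p q} → List (Edge p q) → Set
CondII {p} {q} E = ∀ (i j : Fin (length E)) → i ≢ j →
  ∀ (u u' w w' : Vertex p q) → Ends (lookup E i) u u' → Ends (lookup E j) w w' →
  col u ≡ col w → col u' ≢ col w'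

CondIII : ∀ {p q} → List (Edge p q) → Set
CondIII {p} {q} E = ∀ (c : Fin q) (r r' : Fin p) →
  ¬ Saturated E (r , c) → ¬ Saturated E (r' , c) → r ≡ r'

module Submission where

-- Let k = ⌊p/2⌋ and pair row e with row k + e for e < k: the vertex in column c of row e is
-- matched with the vertex in column c + (e + 1) mod q of row k + e.  Each edge crosses columns
-- since 0 < e + 1 < q.  If endpoints of two distinct edges share a column, the other endpoints
-- cannot also share one: either both edges leave the shared column forwards, with different
-- offsets e + 1 ≠ e′ + 1, or one leaves it forwards and the other backwards, and closing up the
-- columns would take a rotation by (e + 1) + (e′ + 1) ≤ 2k < q.  Every row is matched except
-- row 2k when p is odd.

open import Defs
open import Data.Empty using (⊥-elim)
open import Function using (_∘_; case_of_)
open import Data.Fin using (Fin; zero; suc; toℕ; _↑ˡ_; _↑ʳ_; splitAt)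
open import Data.Fin.Properties
  using (toℕ-fromℕ<; toℕ-injective; toℕ<n; ↑ˡ-injective; ↑ʳ-injective; splitAt-↑ˡ; splitAt-↑ʳ; splitAt⁻¹-↑ˡ; splitAt⁻¹-↑ʳ)
open import Data.List using (List; _∷_; map; lookup; cartesianProduct; allFin)
open import Data.List.Membership.Propositional using (_∈_)
open import Data.List.Membership.Propositional.Properties using (∈-lookup; ∈-map⁺; ∈-map⁻; ∈-cartesianProduct⁺; ∈-allFin)
import Data.List.Relation.Unary.All as All
open import Data.List.Relation.Unary.AllPairs using (_∷_)
open import Data.List.Relation.Unary.Any using (index)
open import Data.List.Relation.Unary.Any.Properties using (lookup-index)
open import Data.List.Relation.Unary.Unique.Propositional using (Unique)
open import Data.List.Relation.Unary.Unique.Propositional.Properties using (map⁺; cartesianProduct⁺; allFin⁺)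
open import Data.Nat using (ℕ; zero; suc; _+_; _∸_; _≤_; _<_; z≤n; s≤s; NonZero; >-nonZero)
open import Data.Nat.DivMod using (_%_; _mod_; %-distribˡ-+; m%n%n≡m%n; [m+n]%n≡m%n; m<n⇒m%n≡m)
open import Data.Nat.Properties
open import Data.Product using (Σ; ∃; ∃₂; _×_; _,_; proj₁; proj₂)
open import Data.Sum using (inj₁; inj₂)
open import Relation.Binary.PropositionalEquality
open import Relation.Nullary using (¬_)
open import Relation.Nullary.Irrelevant using (Irrelevant)

halve : ∀ n → ∃₂ λ k r → r ≤ 1 × k + k + r ≡ n
halve zero = 0 , 0 , z≤n , refl
halve (suc zero) = 0 , 1 , s≤s z≤n , refl
halve (suc (suc n)) with halve n
... | k , r , r≤1 , refl = suc k , r , r≤1 , cong (λ m → suc m + r) (+-suc k k)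

Fin-irrelevant : ∀ {n} → n ≤ 1 → Irrelevant (Fin n)
Fin-irrelevant (s≤s z≤n) zero zero = refl

[m%n+o]%n≡[m+o]%n : ∀ m n o .{{_ : NonZero n}} → (m % n + o) % n ≡ (m + o) % n
[m%n+o]%n≡[m+o]%n m n o = begin
  (m % n + o) % n           ≡⟨ %-distribˡ-+ (m % n) o n ⟩
  (m % n % n + o % n) % n   ≡⟨ cong (λ x → (x + o % n) % n) (m%n%n≡m%n m n) ⟩
  (m % n + o % n) % n       ≡⟨ %-distribˡ-+ m o n ⟨
  (m + o) % n               ∎
  where open ≡-Reasoning

lookup-injective : ∀ {A : Set} {xs : List A} → Unique xs →
                   ∀ {i j} → lookup xs i ≡ lookup xs j → i ≡ j
lookup-injective {xs = _ ∷ _} _           {zero}  {zero}  _  = refl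
lookup-injective {xs = _ ∷ _} (x∉xs ∷ _)  {zero}  {suc j} eq = ⊥-elim (All.lookup x∉xs (∈-lookup j) eq)
lookup-injective {xs = _ ∷ _} (x∉xs ∷ _)  {suc i} {zero}  eq = ⊥-elim (All.lookup x∉xs (∈-lookup i) (sym eq))
lookup-injective {xs = _ ∷ _} (_ ∷ uniq)  {suc i} {suc j} eq = cong suc (lookup-injective uniq eq)

module _ {A B : Set} (f : A → B) (xs : List A) where

  lookup-map-image : ∀ i → ∃ λ x → lookup (map f xs) i ≡ f x
  lookup-map-image i = let x , _ , eq = ∈-map⁻ f (∈-lookup {xs = map f xs} i) in x , eq

  lookup-map-all : {P : B → Set} → (∀ x → P (f x)) → ∀ i → P (lookup (map f xs) i)
  lookup-map-all {P} Pf i = let x , eq = lookup-map-image i in subst P (sym eq) (Pf x)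

  lookup-map-pairwise : Unique (map f xs) → {R : B → B → Set} →
                        (∀ x y → x ≢ y → R (f x) (f y)) →
                        ∀ i j → i ≢ j → R (lookup (map f xs) i) (lookup (map f xs) j)
  lookup-map-pairwise uniq {R} Rf i j i≢j =
    let x , eqx = lookup-map-image i
        y , eqy = lookup-map-image j
    in subst₂ R (sym eqx) (sym eqy)
         (Rf x y λ x≡y → i≢j (lookup-injective uniq (trans eqx (trans (cong f x≡y) (sym eqy)))))

  lookup-map-index : ∀ {x} → x ∈ xs → ∃ λ i → lookup (map f xs) i ≡ f x
  lookup-map-index x∈xs = let f[x]∈ = ∈-map⁺ f x∈xs in index f[x]∈ , sym (lookup-index f[x]∈)

module _ {q : ℕ} .{{_ : NonZero q}} where

  rotate : ℕ → Fin q → Fin q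
  rotate d c = (toℕ c + d) mod q

  toℕ-rotate : ∀ d c → toℕ (rotate d c) ≡ (toℕ c + d) % q
  toℕ-rotate d c = toℕ-fromℕ< _

  rotate-rotate : ∀ d e c → rotate e (rotate d c) ≡ rotate (d + e) c
  rotate-rotate d e c = toℕ-injective (begin
    toℕ (rotate e (rotate d c))   ≡⟨ toℕ-rotate e (rotate d c) ⟩
    (toℕ (rotate d c) + e) % q    ≡⟨ cong (λ x → (x + e) % q) (toℕ-rotate d c) ⟩
    ((toℕ c + d) % q + e) % q     ≡⟨ [m%n+o]%n≡[m+o]%n (toℕ c + d) q e ⟩
    (toℕ c + d + e) % q           ≡⟨ cong (_% q) (+-assoc (toℕ c) d e) ⟩
    (toℕ c + (d + e)) % q         ≡⟨ toℕ-rotate (d + e) c ⟨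
    toℕ (rotate (d + e) c)        ∎)
    where open ≡-Reasoning

  rotate-zero : ∀ c → rotate 0 c ≡ c
  rotate-zero c = toℕ-injective (begin
    toℕ (rotate 0 c)   ≡⟨ toℕ-rotate 0 c ⟩
    (toℕ c + 0) % q    ≡⟨ cong (_% q) (+-identityʳ (toℕ c)) ⟩
    toℕ c % q          ≡⟨ m<n⇒m%n≡m (toℕ<n c) ⟩
    toℕ c              ∎)
    where open ≡-Reasoning

  rotate-full : ∀ c → rotate q c ≡ c
  rotate-full c = toℕ-injective (begin
    toℕ (rotate q c)   ≡⟨ toℕ-rotate q c ⟩
    (toℕ c + q) % q    ≡⟨ [m+n]%n≡m%n (toℕ c) q ⟩
    toℕ c % q          ≡⟨ m<n⇒m%n≡m (toℕ<n c) ⟩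
    toℕ c              ∎)
    where open ≡-Reasoning

  rotate-inverseˡ : ∀ {d} c → d ≤ q → rotate (q ∸ d) (rotate d c) ≡ c
  rotate-inverseˡ {d} c d≤q = begin
    rotate (q ∸ d) (rotate d c)   ≡⟨ rotate-rotate d (q ∸ d) c ⟩
    rotate (d + (q ∸ d)) c        ≡⟨ cong (λ e → rotate e c) (m+[n∸m]≡n d≤q) ⟩
    rotate q c                    ≡⟨ rotate-full c ⟩
    c                             ∎
    where open ≡-Reasoning

  rotate-inverseʳ : ∀ {d} c → d ≤ q → rotate d (rotate (q ∸ d) c) ≡ c
  rotate-inverseʳ {d} c d≤q = begin
    rotate d (rotate (q ∸ d) c)   ≡⟨ rotate-rotate (q ∸ d) d c ⟩
    rotate (q ∸ d + d) c          ≡⟨ cong (λ e → rotate e c) (m∸n+n≡m d≤q) ⟩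
    rotate q c                    ≡⟨ rotate-full c ⟩
    c                             ∎
    where open ≡-Reasoning

  rotate-injective : ∀ {d c c′} → d ≤ q → rotate d c ≡ rotate d c′ → c ≡ c′
  rotate-injective {d} {c} {c′} d≤q eq = begin
    c                              ≡⟨ rotate-inverseˡ c d≤q ⟨
    rotate (q ∸ d) (rotate d c)    ≡⟨ cong (rotate (q ∸ d)) eq ⟩
    rotate (q ∸ d) (rotate d c′)   ≡⟨ rotate-inverseˡ c′ d≤q ⟩
    c′                             ∎
    where open ≡-Reasoning

  toℕ-rotate-back : ∀ {d} c → d < q → toℕ (rotate (q ∸ toℕ c) (rotate d c)) ≡ d
  toℕ-rotate-back {d} c d<q = begin
    toℕ (rotate (q ∸ toℕ c) (rotate d c))   ≡⟨ cong toℕ (rotate-rotate d (q ∸ toℕ c) c) ⟩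
    toℕ (rotate (d + (q ∸ toℕ c)) c)        ≡⟨ toℕ-rotate (d + (q ∸ toℕ c)) c ⟩
    (toℕ c + (d + (q ∸ toℕ c))) % q         ≡⟨ cong (_% q) (+-comm (toℕ c) (d + (q ∸ toℕ c))) ⟩
    (d + (q ∸ toℕ c) + toℕ c) % q           ≡⟨ cong (_% q) (+-assoc d (q ∸ toℕ c) (toℕ c)) ⟩
    (d + (q ∸ toℕ c + toℕ c)) % q           ≡⟨ cong (λ x → (d + x) % q) (m∸n+n≡m (<⇒≤ (toℕ<n c))) ⟩
    (d + q) % q                             ≡⟨ [m+n]%n≡m%n d q ⟩
    d % q                                   ≡⟨ m<n⇒m%n≡m d<q ⟩
    d                                       ∎
    where open ≡-Reasoning

  rotate-injectiveˡ : ∀ {d e} c → d < q → e < q → rotate d c ≡ rotate e c → d ≡ e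
  rotate-injectiveˡ {d} {e} c d<q e<q eq = begin
    d                                        ≡⟨ toℕ-rotate-back c d<q ⟨
    toℕ (rotate (q ∸ toℕ c) (rotate d c))    ≡⟨ cong (toℕ ∘ rotate (q ∸ toℕ c)) eq ⟩
    toℕ (rotate (q ∸ toℕ c) (rotate e c))    ≡⟨ toℕ-rotate-back c e<q ⟩
    e                                        ∎
    where open ≡-Reasoning

  rotate-fixed-point-free : ∀ {d} c → 0 < d → d < q → rotate d c ≢ c
  rotate-fixed-point-free c 0<d d<q eq =
    <⇒≢ 0<d (sym (rotate-injectiveˡ c d<q (≤-<-trans z≤n d<q) (trans eq (sym (rotate-zero c)))))

module Construction (k r : ℕ) {q : ℕ} .{{_ : NonZero q}} (k+k<q : k + k < q) where

  top bottom : Fin k → Fin (k + k + r)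
  top e = (e ↑ˡ k) ↑ˡ r
  bottom e = (k ↑ʳ e) ↑ˡ r

  spare : Fin r → Fin (k + k + r)
  spare j = (k + k) ↑ʳ j

  data RowView : Fin (k + k + r) → Set where
    top-row    : ∀ e → RowView (top e)
    bottom-row : ∀ e → RowView (bottom e)
    spare-row  : ∀ j → RowView (spare j)

  rowView : ∀ i → RowView i
  rowView i with splitAt (k + k) i in eq
  ... | inj₂ j = subst RowView (splitAt⁻¹-↑ʳ eq) (spare-row j)
  ... | inj₁ i′ with splitAt k i′ in eq′
  ...   | inj₁ e = subst RowView (trans (cong (_↑ˡ r) (splitAt⁻¹-↑ˡ eq′)) (splitAt⁻¹-↑ˡ eq)) (top-row e)
  ...   | inj₂ e = subst RowView (trans (cong (_↑ˡ r) (splitAt⁻¹-↑ʳ eq′)) (splitAt⁻¹-↑ˡ eq)) (bottom-row e)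

  top-injective : ∀ {e e′} → top e ≡ top e′ → e ≡ e′
  top-injective eq = ↑ˡ-injective k _ _ (↑ˡ-injective r _ _ eq)

  bottom-injective : ∀ {e e′} → bottom e ≡ bottom e′ → e ≡ e′
  bottom-injective eq = ↑ʳ-injective k _ _ (↑ˡ-injective r _ _ eq)

  top≢bottom : ∀ e e′ → top e ≢ bottom e′
  top≢bottom e e′ eq = case splitAt-top≡splitAt-bottom of λ ()
    where
    open ≡-Reasoning
    splitAt-top≡splitAt-bottom : inj₁ e ≡ inj₂ e′
    splitAt-top≡splitAt-bottom = begin
      inj₁ e                ≡⟨ splitAt-↑ˡ k e k ⟨
      splitAt k (e ↑ˡ k)    ≡⟨ cong (splitAt k) (↑ˡ-injective r _ _ eq) ⟩
      splitAt k (k ↑ʳ e′)   ≡⟨ splitAt-↑ʳ k k e′ ⟩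
      inj₂ e′               ∎

  offset : Fin k → ℕ
  offset e = suc (toℕ e)

  offset+offset<q : ∀ e e′ → offset e + offset e′ < q
  offset+offset<q e e′ = ≤-<-trans (+-mono-≤ (toℕ<n e) (toℕ<n e′)) k+k<q

  offset<q : ∀ e → offset e < q
  offset<q e = ≤-<-trans (m≤m+n (offset e) (offset e)) (offset+offset<q e e)

  edge : Fin q × Fin k → Edge (k + k + r) q
  edge (c , e) = (top e , c) , (bottom e , rotate (offset e) c)

  edge-columns-differ : ∀ x → col (proj₁ (edge x)) ≢ col (proj₂ (edge x))
  edge-columns-differ (c , e) eq = rotate-fixed-point-free c (s≤s z≤n) (offset<q e) (sym eq)

  edge-top-injective : ∀ {x y} → proj₁ (edge x) ≡ proj₁ (edge y) → x ≡ y
  edge-top-injective eq = cong₂ _,_ (cong proj₂ eq) (top-injective (cong proj₁ eq))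

  edge-bottom-injective : ∀ {x y} → proj₂ (edge x) ≡ proj₂ (edge y) → x ≡ y
  edge-bottom-injective {_ , e} eq with bottom-injective (cong proj₁ eq)
  ... | refl = cong (_, e) (rotate-injective (<⇒≤ (offset<q e)) (cong proj₂ eq))

  edge-top≢bottom : ∀ x y → proj₁ (edge x) ≢ proj₂ (edge y)
  edge-top≢bottom (_ , e) (_ , e′) eq = top≢bottom e e′ (cong proj₁ eq)

  edge-disjoint : ∀ x y → x ≢ y → ∀ v → v ∈ₑ edge x → ¬ (v ∈ₑ edge y)
  edge-disjoint x y x≢y _ (inj₁ refl) (inj₁ eq) = x≢y (edge-top-injective eq)
  edge-disjoint x y x≢y _ (inj₁ refl) (inj₂ eq) = edge-top≢bottom x y eq
  edge-disjoint x y x≢y _ (inj₂ refl) (inj₁ eq) = edge-top≢bottom y x (sym eq)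
  edge-disjoint x y x≢y _ (inj₂ refl) (inj₂ eq) = x≢y (edge-bottom-injective eq)

  edge-determined-by-columns : ∀ {c c′ e e′} → c ≡ c′ →
    rotate (offset e) c ≡ rotate (offset e′) c′ → (c , e) ≡ (c′ , e′)
  edge-determined-by-columns {c} {e = e} {e′} refl eq =
    cong (c ,_) (toℕ-injective (suc-injective (rotate-injectiveˡ c (offset<q e) (offset<q e′) eq)))

  -- Going from c to c′ and back would be a rotation by offset e + offset e′, which is less than q.
  edge-columns-not-reversed : ∀ {c c′ e e′} → c ≡ rotate (offset e′) c′ → rotate (offset e) c ≢ c′
  edge-columns-not-reversed {c} {c′} {e} {e′} c≡ c′≡ =
    rotate-fixed-point-free c (s≤s z≤n) (offset+offset<q e e′) (begin
      rotate (offset e + offset e′) c            ≡⟨ rotate-rotate (offset e) (offset e′) c ⟨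
      rotate (offset e′) (rotate (offset e) c)   ≡⟨ cong (rotate (offset e′)) c′≡ ⟩
      rotate (offset e′) c′                      ≡⟨ c≡ ⟨
      c                                          ∎)
    where open ≡-Reasoning

  edge-condII : ∀ x y → x ≢ y → ∀ u u′ w w′ → Ends (edge x) u u′ → Ends (edge y) w w′ →
                col u ≡ col w → col u′ ≢ col w′
  edge-condII x y x≢y _ _ _ _ (inj₁ refl) (inj₁ refl) u~w u′~w′ = x≢y (edge-determined-by-columns u~w u′~w′)
  edge-condII _ _ _   _ _ _ _ (inj₁ refl) (inj₂ refl) u~w       = edge-columns-not-reversed u~w
  edge-condII _ _ _   _ _ _ _ (inj₂ refl) (inj₁ refl) u~w u′~w′ = edge-columns-not-reversed u′~w′ u~w
  edge-condII x y x≢y _ _ _ _ (inj₂ refl) (inj₂ refl) u~w u′~w′ = x≢y (edge-determined-by-columns u′~w′ u~w)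

  top-covered : ∀ e c → (top e , c) ∈ₑ edge (c , e)
  top-covered e c = inj₁ refl

  bottom-covered : ∀ e c → (bottom e , c) ∈ₑ edge (rotate (q ∸ offset e) c , e)
  bottom-covered e c = inj₂ (cong (bottom e ,_) (sym (rotate-inverseʳ c (<⇒≤ (offset<q e)))))

  pairs : List (Fin q × Fin k)
  pairs = cartesianProduct (allFin q) (allFin k)

  edges : List (Edge (k + k + r) q)
  edges = map edge pairs

  edges-unique : Unique edges
  edges-unique = map⁺ (edge-top-injective ∘ cong proj₁) (cartesianProduct⁺ (allFin⁺ q) (allFin⁺ k))

  edge-saturates : ∀ x {v} → v ∈ₑ edge x → Saturated edges v
  edge-saturates (c , e) {v} v∈ =
    let i , eq = lookup-map-index edge pairs (∈-cartesianProduct⁺ (∈-allFin c) (∈-allFin e))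
    in i , subst (v ∈ₑ_) (sym eq) v∈

  unsaturated⇒spare : ∀ {i} c → ¬ Saturated edges (i , c) → ∃ λ j → spare j ≡ i
  unsaturated⇒spare {i} c unsat with rowView i
  ... | top-row e    = ⊥-elim (unsat (edge-saturates _ (top-covered e c)))
  ... | bottom-row e = ⊥-elim (unsat (edge-saturates _ (bottom-covered e c)))
  ... | spare-row j  = j , refl

  edges-condI : CondI edges
  edges-condI = lookup-map-all edge pairs {P = λ e → col (proj₁ e) ≢ col (proj₂ e)} edge-columns-differ

  edges-isMatching : IsMatching edges
  edges-isMatching = record
    { loopless = λ i eq → edges-condI i (cong col eq)
    ; disjoint = lookup-map-pairwise edge pairs edges-unique
                   {R = λ e₁ e₂ → ∀ v → v ∈ₑ e₁ → ¬ (v ∈ₑ e₂)} edge-disjoint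
    }

  edges-condII : CondII edges
  edges-condII = lookup-map-pairwise edge pairs edges-unique
    {R = λ e₁ e₂ → ∀ u u′ w w′ → Ends e₁ u u′ → Ends e₂ w w′ → col u ≡ col w → col u′ ≢ col w′}
    edge-condII

  edges-condIII : r ≤ 1 → CondIII edges
  edges-condIII r≤1 c i i′ unsat unsat′ with unsaturated⇒spare c unsat | unsaturated⇒spare c unsat′
  ... | j , refl | j′ , refl = cong spare (Fin-irrelevant r≤1 j j′)

lemma1 : (p q : ℕ) → 1 ≤ p → p < q →
    Σ (List (Edge p q)) λ E → IsMatching E × CondI E × CondII E × CondIII E
lemma1 p q _ p<q with halve p
... | k , r , r≤1 , refl = edges , edges-isMatching , edges-condI , edges-condII , edges-condIII r≤1
  where
  instance
    q≢0 : NonZero q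
    q≢0 = >-nonZero (≤-<-trans z≤n p<q)
  open Construction k r (≤-<-trans (m≤m+n (k + k) r) p<q)
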